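{- Let $G$ be a minimal non-weakly flat path extendable graph and let $v\in V(G)$. Then $v$ is not adjacent to every vertex of $V(G)\setminus\{v\}$.
   Context: A hole is an induced cycle with at least four vertices; chordal means no hole. For a path $P$, $N[P]$ is the set of vertices in $P$ or with a neighbor in $P$. $G$ is weakly flat path extendable (weakly FPE) if for every path $P$ with one or two vertices and every two sets $W_1,W_2$ with $G[W_1],G[W_2]$ chordal, $W_1\cap W_2=V(P)$, $W_1\cup W_2=N[P]$, there exist $X_1\supseteq W_1$, $X_2\supseteq W_2$ with $G[X_1],G[X_2]$ chordal, $X_1\cap X_2=V(P)$, $X_1\cup X_2=V(G)$. $G$ is minimal non-weakly FPE if $G$ is not weakly FPE but every proper induced subgraph of $G$ is weakly FPE. -}

module Defs where

open import Data.Nat using (ℕ; zero; suc; _∸_; _≤_)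
open import Data.Fin using (Fin; toℕ)
open import Data.Fin.Subset using (Subset; _∈_; _⊂_; ⊤)
open import Data.Product using (Σ; ∃; _×_; _,_)
open import Data.Sum using (_⊎_)
open import Data.Empty using (⊥)
open import Relation.Nullary using (¬_; Dec)
open import Relation.Binary.PropositionalEquality using (_≡_; _≢_)
open import Function.Definitions using (Injective)
open import Function.Bundles using (_⇔_)

record Graph : Set₁ where
  field
    n      : ℕ
    _~_    : Fin n → Fin n → Set
    sym    : ∀ {u v} → u ~ v → v ~ u
    irrefl : ∀ {u} → ¬ (u ~ u)
    dec    : ∀ u v → Dec (u ~ v)

module _ (G : Graph) where
  open Graph G

  CycAdj : (k : ℕ) → Fin k → Fin k → Set
  CycAdj k i j =
      (toℕ j ≡ suc (toℕ i)) ⊎ (toℕ i ≡ suc (toℕ j))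
    ⊎ ((toℕ i ≡ 0 × toℕ j ≡ k ∸ 1) ⊎ (toℕ j ≡ 0 × toℕ i ≡ k ∸ 1))

  -- A hole of G[X]: an induced cycle of G with at least four vertices, all in X.
  Hole : Subset n → Set
  Hole X = Σ ℕ λ k → (4 ≤ k) × Σ (Fin k → Fin n) λ c →
             Injective _≡_ _≡_ c
           × (∀ i → c i ∈ X)
           × (∀ i j → (c i ~ c j) ⇔ CycAdj k i j)

  Chordal : Subset n → Set
  Chordal X = ¬ Hole X

  data SmallPath (U : Subset n) : Set where
    one : (u : Fin n) → u ∈ U → SmallPath U
    two : (u v : Fin n) → u ∈ U → v ∈ U → u ~ v → SmallPath U

  InP : ∀ {U} → SmallPath U → Fin n → Set
  InP (one u _) w = w ≡ u
  InP (two u v _ _ _) w = (w ≡ u) ⊎ (w ≡ v)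

  InNP : ∀ {U} → SmallPath U → Fin n → Set
  InNP {U} P w = w ∈ U × (InP P w ⊎ ∃ λ p → InP P p × (w ~ p))

  WeaklyFPE : Subset n → Set
  WeaklyFPE U =
    ∀ (P : SmallPath U) (W₁ W₂ : Subset n) →
      Chordal W₁ → Chordal W₂ →
      (∀ w → ((w ∈ W₁) × (w ∈ W₂)) ⇔ InP P w) →
      (∀ w → ((w ∈ W₁) ⊎ (w ∈ W₂)) ⇔ InNP P w) →
      Σ (Subset n) λ X₁ → Σ (Subset n) λ X₂ →
          (∀ w → w ∈ W₁ → w ∈ X₁)
        × (∀ w → w ∈ W₂ → w ∈ X₂)
        × Chordal X₁ × Chordal X₂
        × (∀ w → ((w ∈ X₁) × (w ∈ X₂)) ⇔ InP P w)
        × (∀ w → ((w ∈ X₁) ⊎ (w ∈ X₂)) ⇔ (w ∈ U))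

  MinimalNonWeaklyFPE : Set
  MinimalNonWeaklyFPE = ¬ WeaklyFPE ⊤ × (∀ U → U ⊂ ⊤ → WeaklyFPE U)

{-# OPTIONS --safe #-}
module Submission where

-- Every vertex of a hole has a non-neighbour on the hole, so a vertex v adjacent to all
-- other vertices lies on no hole, and adding v to a chordal set keeps it chordal. Given
-- a path P and a split (W₁, W₂) of N[P] in G: if v ∈ P then N[P] = V(G) and (W₁, W₂)
-- already is an extension; otherwise v ∉ P, the split restricted to G − v is solved by
-- minimality, and v is added back to whichever Wᵢ contains it.

open import Defs
open import Data.Fin using (Fin; toℕ; fromℕ<; _≟_)
open import Data.Fin.Properties using (toℕ<n; toℕ-fromℕ<; any?)
open import Data.Fin.Subset using (Subset; _∈_; _∉_; _⊆_; _⊂_; ⊤; ∁; ⁅_⁆; _∪_; _∩_)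
open import Data.Fin.Subset.Properties
  using (∈⊤; x∈⁅x⁆; x∈⁅y⁆⇒x≡y; x≢y⇒x∉⁅y⁆; x∉⁅y⁆⇒x≢y; x∈∁p⇒x∉p; x∉p⇒x∈∁p; x∈p⇒x∉∁p;
         p∩q⊆p; p∩q⊆q; x∈p∩q⁺; x∈p∩q⁻; x∈p∪q⁺; x∈p∪q⁻)
open import Data.Nat using (ℕ; zero; suc; _∸_; _≤_; _<_; s≤s; z≤n)
open import Data.Nat.Properties using (≤-trans; m≤n+m)
open import Data.Product using (∃; _×_; _,_; proj₁; proj₂)
open import Data.Sum using (_⊎_; inj₁; inj₂; [_,_]′; map)
open import Function using (id; _∘_)
open import Function.Bundles using (_⇔_; mk⇔; Equivalence)
import Function.Properties.Equivalence as ⇔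
open import Relation.Nullary using (¬_; Dec; yes; no; contradiction)
open import Relation.Nullary.Decidable using (_⊎-dec_)
open import Relation.Binary.PropositionalEquality using (_≡_; _≢_; refl; sym; trans; cong; subst)

CyclicallyAdjacent : ℕ → ℕ → ℕ → Set
CyclicallyAdjacent k i j =
  (j ≡ suc i) ⊎ (i ≡ suc j) ⊎ ((i ≡ 0 × j ≡ k ∸ 1) ⊎ (j ≡ 0 × i ≡ k ∸ 1))

non-adjacent-position : ∀ {k} → 4 ≤ k → ∀ {i} → i < k →
                        ∃ λ j → j < k × j ≢ i × ¬ CyclicallyAdjacent k i j
non-adjacent-position (s≤s (s≤s (s≤s (s≤s _)))) {zero} _ =
  2 , s≤s (s≤s (s≤s z≤n)) , (λ ()) ,
  λ { (inj₁ ()) ; (inj₂ (inj₁ ())) ; (inj₂ (inj₂ (inj₁ (_ , ())))) ; (inj₂ (inj₂ (inj₂ (() , _)))) }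
non-adjacent-position (s≤s (s≤s (s≤s (s≤s _)))) {suc zero} _ =
  3 , s≤s (s≤s (s≤s (s≤s z≤n))) , (λ ()) ,
  λ { (inj₁ ()) ; (inj₂ (inj₁ ())) ; (inj₂ (inj₂ (inj₁ (() , _)))) ; (inj₂ (inj₂ (inj₂ (() , _)))) }
non-adjacent-position (s≤s (s≤s (s≤s (s≤s _)))) {suc (suc m)} m+2<k =
  m , ≤-trans (m≤n+m (suc m) 2) m+2<k , (λ ()) ,
  λ { (inj₁ ()) ; (inj₂ (inj₁ ())) ; (inj₂ (inj₂ (inj₁ (() , _)))) ; (inj₂ (inj₂ (inj₂ (refl , ())))) }

module _ {n : ℕ} where

  x∈∁⁅y⁆⇒x≢y : ∀ {x y : Fin n} → x ∈ ∁ ⁅ y ⁆ → x ≢ y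
  x∈∁⁅y⁆⇒x≢y = x∉⁅y⁆⇒x≢y ∘ x∈∁p⇒x∉p

  x≢y⇒x∈∁⁅y⁆ : ∀ {x y : Fin n} → x ≢ y → x ∈ ∁ ⁅ y ⁆
  x≢y⇒x∈∁⁅y⁆ = x∉p⇒x∈∁p ∘ x≢y⇒x∉⁅y⁆

  ∁⁅x⁆⊂⊤ : ∀ (x : Fin n) → ∁ ⁅ x ⁆ ⊂ ⊤
  ∁⁅x⁆⊂⊤ x = (λ _ → ∈⊤) , x , ∈⊤ , x∈p⇒x∉∁p (x∈⁅x⁆ x)

  x∈p∪⁅y⁆∧x≢y⇒x∈p : ∀ {p : Subset n} {x y} → x ∈ p ∪ ⁅ y ⁆ → x ≢ y → x ∈ p
  x∈p∪⁅y⁆∧x≢y⇒x∈p {p} {y = y} x∈ x≢y =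
    [ id , (λ x∈⁅y⁆ → contradiction (x∈⁅y⁆⇒x≡y y x∈⁅y⁆) x≢y) ]′ (x∈p∪q⁻ p ⁅ y ⁆ x∈)

  p∪q∩r⊆p∪r : ∀ (p q r : Subset n) → p ∪ (q ∩ r) ⊆ p ∪ r
  p∪q∩r⊆p∪r p q r = x∈p∪q⁺ ∘ [ inj₁ , inj₂ ∘ p∩q⊆q q r ]′ ∘ x∈p∪q⁻ p (q ∩ r)

  y∈p∪q∩⁅y⁆∧y∉p⇒y∈q : ∀ {p q : Subset n} {y} → y ∈ p ∪ (q ∩ ⁅ y ⁆) → y ∉ p → y ∈ q
  y∈p∪q∩⁅y⁆∧y∉p⇒y∈q {p} {q} {y} y∈ y∉p =
    [ (λ y∈p → contradiction y∈p y∉p) , p∩q⊆p q ⁅ y ⁆ ]′ (x∈p∪q⁻ p (q ∩ ⁅ y ⁆) y∈)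

  x∈p∪q∩⁅y⁆∧x≢y⇒x∈p : ∀ {p q : Subset n} {x y} → x ∈ p ∪ (q ∩ ⁅ y ⁆) → x ≢ y → x ∈ p
  x∈p∪q∩⁅y⁆∧x≢y⇒x∈p {p} {q} {y = y} = x∈p∪⁅y⁆∧x≢y⇒x∈p ∘ p∪q∩r⊆p∪r p q ⁅ y ⁆

  ⊆-∪-∩⁅⁆ : ∀ {p q : Subset n} {y} → q ∩ ∁ ⁅ y ⁆ ⊆ p → q ⊆ p ∪ (q ∩ ⁅ y ⁆)
  ⊆-∪-∩⁅⁆ {y = y} q∖y⊆p {x} x∈q with x ≟ y
  ... | yes refl = x∈p∪q⁺ (inj₂ (x∈p∩q⁺ (x∈q , x∈⁅x⁆ x)))
  ... | no x≢y   = x∈p∪q⁺ (inj₁ (q∖y⊆p (x∈p∩q⁺ (x∈q , x≢y⇒x∈∁⁅y⁆ x≢y))))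

  IntersectionIs : Subset n → Subset n → (Fin n → Set) → Set
  IntersectionIs A B S = ∀ w → (w ∈ A × w ∈ B) ⇔ S w

  UnionIs : Subset n → Subset n → (Fin n → Set) → Set
  UnionIs A B S = ∀ w → (w ∈ A ⊎ w ∈ B) ⇔ S w

  UnionIs-cong : ∀ {A B S T} → (∀ w → S w ⇔ T w) → UnionIs A B S → UnionIs A B T
  UnionIs-cong S⇔T A∪B w = ⇔.trans (A∪B w) (S⇔T w)

  IntersectionIs-cong : ∀ {A B S T} → (∀ w → S w ⇔ T w) → IntersectionIs A B S → IntersectionIs A B T
  IntersectionIs-cong S⇔T A∩B w = ⇔.trans (A∩B w) (S⇔T w)

  IntersectionIs-∩ : ∀ {A B S} U → (∀ {w} → S w → w ∈ U) →
                     IntersectionIs A B S → IntersectionIs (A ∩ U) (B ∩ U) S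
  IntersectionIs-∩ {A} {B} U S⊆U A∩B w = mk⇔
    (λ (w∈A∩U , w∈B∩U) → Equivalence.to (A∩B w) (p∩q⊆p A U w∈A∩U , p∩q⊆p B U w∈B∩U))
    (λ s → let (w∈A , w∈B) = Equivalence.from (A∩B w) s
           in x∈p∩q⁺ (w∈A , S⊆U s) , x∈p∩q⁺ (w∈B , S⊆U s))

  UnionIs-∩ : ∀ {A B S} U → UnionIs A B S → UnionIs (A ∩ U) (B ∩ U) (λ w → w ∈ U × S w)
  UnionIs-∩ {A} {B} U A∪B w = mk⇔
    [ (λ w∈A∩U → let (w∈A , w∈U) = x∈p∩q⁻ A U w∈A∩U in w∈U , Equivalence.to (A∪B w) (inj₁ w∈A))
    , (λ w∈B∩U → let (w∈B , w∈U) = x∈p∩q⁻ B U w∈B∩U in w∈U , Equivalence.to (A∪B w) (inj₂ w∈B)) ]′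
    (λ (w∈U , s) → [ (λ w∈A → inj₁ (x∈p∩q⁺ (w∈A , w∈U))) , (λ w∈B → inj₂ (x∈p∩q⁺ (w∈B , w∈U))) ]′
                     (Equivalence.from (A∪B w) s))

module _ (G : Graph) where
  open Graph G using (n; _~_)

  Universal : Fin n → Set
  Universal v = ∀ w → w ≢ v → v ~ w

  non-adjacent-on-cycle : ∀ {k} → 4 ≤ k → (i : Fin k) → ∃ λ j → j ≢ i × ¬ CycAdj G k i j
  non-adjacent-on-cycle {k} 4≤k i with non-adjacent-position 4≤k (toℕ<n i)
  ... | j , j<k , j≢i , ¬adj =
    fromℕ< j<k ,
    (λ j≡i → j≢i (trans (sym (toℕ-fromℕ< j<k)) (cong toℕ j≡i))) ,
    ¬adj ∘ subst (CyclicallyAdjacent k (toℕ i)) (toℕ-fromℕ< j<k)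

  chordal-⊆ : ∀ {X Y} → Y ⊆ X → Chordal G X → Chordal G Y
  chordal-⊆ Y⊆X chordal (k , 4≤k , c , c-inj , c∈Y , c-adj) =
    chordal (k , 4≤k , c , c-inj , Y⊆X ∘ c∈Y , c-adj)

  chordal-∪-dominating : ∀ {X v} → (∀ {w} → w ∈ X → w ≢ v → v ~ w) →
                         Chordal G X → Chordal G (X ∪ ⁅ v ⁆)
  chordal-∪-dominating {X} {v} dominates chordal (k , 4≤k , c , c-inj , c∈ , c-adj)
    with any? (λ i → c i ≟ v)
  ... | yes (i , refl) =
    let (j , j≢i , ¬ij) = non-adjacent-on-cycle 4≤k i
        cj≢ci = j≢i ∘ c-inj
    in ¬ij (Equivalence.to (c-adj i j) (dominates (x∈p∪⁅y⁆∧x≢y⇒x∈p (c∈ j) cj≢ci) cj≢ci))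
  ... | no v∉c =
    chordal (k , 4≤k , c , c-inj , (λ i → x∈p∪⁅y⁆∧x≢y⇒x∈p (c∈ i) (v∉c ∘ (i ,_))) , c-adj)

  Extension : (U : Subset n) → SmallPath G U → Subset n → Subset n → Set
  Extension U P W₁ W₂ = ∃ λ X₁ → ∃ λ X₂ →
      (∀ w → w ∈ W₁ → w ∈ X₁)
    × (∀ w → w ∈ W₂ → w ∈ X₂)
    × Chordal G X₁ × Chordal G X₂
    × IntersectionIs X₁ X₂ (InP G P)
    × UnionIs X₁ X₂ (_∈ U)

  trivial-extension : ∀ {U} (P : SmallPath G U) {W₁ W₂} → (∀ w → w ∈ U → InNP G P w) →
                      Chordal G W₁ → Chordal G W₂ →
                      IntersectionIs W₁ W₂ (InP G P) → UnionIs W₁ W₂ (InNP G P) →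
                      Extension U P W₁ W₂
  trivial-extension P N[P]-spans ch₁ ch₂ W₁∩W₂ W₁∪W₂ =
    _ , _ , (λ _ → id) , (λ _ → id) , ch₁ , ch₂ , W₁∩W₂ ,
    UnionIs-cong (λ w → mk⇔ proj₁ (λ w∈U → w∈U , proj₂ (N[P]-spans w w∈U))) W₁∪W₂

  InP? : ∀ {U} (P : SmallPath G U) → ∀ w → Dec (InP G P w)
  InP? (one u _)         w = w ≟ u
  InP? (two u u′ _ _ _)  w = (w ≟ u) ⊎-dec (w ≟ u′)

  restrict : ∀ {U V} (P : SmallPath G U) → (∀ {w} → InP G P w → w ∈ V) → SmallPath G V
  restrict (one u _)         P⊆V = one u (P⊆V refl)
  restrict (two u u′ _ _ uu′) P⊆V = two u u′ (P⊆V (inj₁ refl)) (P⊆V (inj₂ refl)) uu′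

  InP-restrict : ∀ {U V} (P : SmallPath G U) (P⊆V : ∀ {w} → InP G P w → w ∈ V) → ∀ w →
                 InP G (restrict P P⊆V) w ⇔ InP G P w
  InP-restrict (one _ _)         _ _ = mk⇔ id id
  InP-restrict (two _ _ _ _ _)   _ _ = mk⇔ id id

  InNP-restrict : ∀ {U V} → V ⊆ U → (P : SmallPath G U) (P⊆V : ∀ {w} → InP G P w → w ∈ V) → ∀ w →
                  InNP G (restrict P P⊆V) w ⇔ (w ∈ V × InNP G P w)
  InNP-restrict V⊆U (one _ _)       _ _ =
    mk⇔ (λ (w∈V , near) → w∈V , V⊆U w∈V , near) (λ (w∈V , _ , near) → w∈V , near)
  InNP-restrict V⊆U (two _ _ _ _ _) _ _ =
    mk⇔ (λ (w∈V , near) → w∈V , V⊆U w∈V , near) (λ (w∈V , _ , near) → w∈V , near)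

  start : ∀ {U} → SmallPath G U → Fin n
  start (one u _)       = u
  start (two u _ _ _ _) = u

  start∈P : ∀ {U} (P : SmallPath G U) → InP G P (start P)
  start∈P (one _ _)       = refl
  start∈P (two _ _ _ _ _) = inj₁ refl

  module _ {v : Fin n} (universal : Universal v) where

    N[P]-spans : (P : SmallPath G ⊤) → InP G P v → ∀ w → w ∈ ⊤ → InNP G P w
    N[P]-spans P v∈P w _ with w ≟ v
    ... | yes refl = ∈⊤ , inj₁ v∈P
    ... | no w≢v   = ∈⊤ , inj₂ (v , v∈P , Graph.sym G (universal w w≢v))

    P⊆∁⁅v⁆ : ∀ {U} {P : SmallPath G U} → ¬ InP G P v → ∀ {w} → InP G P w → w ∈ ∁ ⁅ v ⁆
    P⊆∁⁅v⁆ {P = P} v∉P w∈P = x≢y⇒x∈∁⁅y⁆ (λ w≡v → v∉P (subst (InP G P) w≡v w∈P))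

    v∈N[P] : (P : SmallPath G ⊤) → ¬ InP G P v → InNP G P v
    v∈N[P] P v∉P = ∈⊤ , inj₂ (start P , start∈P P ,
                              universal (start P) (x∈∁⁅y⁆⇒x≢y (P⊆∁⁅v⁆ v∉P (start∈P P))))

    extension-∪-⁅⁆ : (P : SmallPath G ⊤) (v∉P : ¬ InP G P v) {W₁ W₂ : Subset n} →
                     IntersectionIs W₁ W₂ (InP G P) → UnionIs W₁ W₂ (InNP G P) →
                     Extension (∁ ⁅ v ⁆) (restrict P (P⊆∁⁅v⁆ v∉P)) (W₁ ∩ ∁ ⁅ v ⁆) (W₂ ∩ ∁ ⁅ v ⁆) →
                     Extension ⊤ P W₁ W₂
    extension-∪-⁅⁆ P v∉P {W₁} {W₂} W₁∩W₂ W₁∪W₂ (X₁ , X₂ , W₁⊆X₁ , W₂⊆X₂ , ch₁ , ch₂ , X₁∩X₂ , X₁∪X₂) =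
      X₁ ∪ (W₁ ∩ ⁅ v ⁆) , X₂ ∪ (W₂ ∩ ⁅ v ⁆) ,
      (λ _ → ⊆-∪-∩⁅⁆ (W₁⊆X₁ _)) , (λ _ → ⊆-∪-∩⁅⁆ (W₂⊆X₂ _)) ,
      chordal-adjoin ch₁ , chordal-adjoin ch₂ ,
      (λ w → mk⇔ (meet w) (λ w∈P → let (w∈X₁ , w∈X₂) = Equivalence.from (X₁∩X₂ w) (restrict⁻ w w∈P)
                                  in x∈p∪q⁺ (inj₁ w∈X₁) , x∈p∪q⁺ (inj₁ w∈X₂))) ,
      (λ w → mk⇔ (λ _ → ∈⊤) (cover w))
      where
      restrict⁻ : ∀ w → InP G P w → InP G (restrict P (P⊆∁⁅v⁆ v∉P)) w
      restrict⁻ w = Equivalence.from (InP-restrict P (P⊆∁⁅v⁆ v∉P) w)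

      chordal-adjoin : ∀ {X W} → Chordal G X → Chordal G (X ∪ (W ∩ ⁅ v ⁆))
      chordal-adjoin {X} {W} = chordal-⊆ (p∪q∩r⊆p∪r X W ⁅ v ⁆) ∘ chordal-∪-dominating (λ {w} _ → universal w)

      v∉X : ∀ {w} → w ∈ X₁ ⊎ w ∈ X₂ → w ≢ v
      v∉X = x∈∁⁅y⁆⇒x≢y ∘ Equivalence.to (X₁∪X₂ _)

      meet : ∀ w → w ∈ X₁ ∪ (W₁ ∩ ⁅ v ⁆) × w ∈ X₂ ∪ (W₂ ∩ ⁅ v ⁆) → InP G P w
      meet w (w∈X₁′ , w∈X₂′) with w ≟ v
      ... | yes refl = Equivalence.to (W₁∩W₂ v)
        ( y∈p∪q∩⁅y⁆∧y∉p⇒y∈q w∈X₁′ (λ v∈X₁ → v∉X (inj₁ v∈X₁) refl)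
        , y∈p∪q∩⁅y⁆∧y∉p⇒y∈q w∈X₂′ (λ v∈X₂ → v∉X (inj₂ v∈X₂) refl))
      ... | no w≢v = Equivalence.to (InP-restrict P (P⊆∁⁅v⁆ v∉P) w) (Equivalence.to (X₁∩X₂ w)
        (x∈p∪q∩⁅y⁆∧x≢y⇒x∈p w∈X₁′ w≢v , x∈p∪q∩⁅y⁆∧x≢y⇒x∈p w∈X₂′ w≢v))

      cover : ∀ w → w ∈ ⊤ → w ∈ X₁ ∪ (W₁ ∩ ⁅ v ⁆) ⊎ w ∈ X₂ ∪ (W₂ ∩ ⁅ v ⁆)
      cover w _ with w ≟ v
      ... | yes refl = map (λ v∈W₁ → x∈p∪q⁺ (inj₂ (x∈p∩q⁺ (v∈W₁ , x∈⁅x⁆ v))))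
                           (λ v∈W₂ → x∈p∪q⁺ (inj₂ (x∈p∩q⁺ (v∈W₂ , x∈⁅x⁆ v))))
                           (Equivalence.from (W₁∪W₂ v) (v∈N[P] P v∉P))
      ... | no w≢v   = map (x∈p∪q⁺ ∘ inj₁) (x∈p∪q⁺ ∘ inj₁) (Equivalence.from (X₁∪X₂ w) (x≢y⇒x∈∁⁅y⁆ w≢v))

    weaklyFPE-∁⁅v⁆⇒weaklyFPE : WeaklyFPE G (∁ ⁅ v ⁆) → WeaklyFPE G ⊤
    weaklyFPE-∁⁅v⁆⇒weaklyFPE fpe P W₁ W₂ ch₁ ch₂ W₁∩W₂ W₁∪W₂ with InP? P v
    ... | yes v∈P = trivial-extension P (N[P]-spans P v∈P) ch₁ ch₂ W₁∩W₂ W₁∪W₂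
    ... | no v∉P  = extension-∪-⁅⁆ P v∉P W₁∩W₂ W₁∪W₂
      (fpe (restrict P P⊆U) (W₁ ∩ U) (W₂ ∩ U)
           (chordal-⊆ (p∩q⊆p W₁ U) ch₁) (chordal-⊆ (p∩q⊆p W₂ U) ch₂)
           (IntersectionIs-cong (λ w → ⇔.sym (InP-restrict P P⊆U w)) (IntersectionIs-∩ U P⊆U W₁∩W₂))
           (UnionIs-cong (λ w → ⇔.sym (InNP-restrict (λ _ → ∈⊤) P P⊆U w)) (UnionIs-∩ U W₁∪W₂)))
      where
      U = ∁ ⁅ v ⁆
      P⊆U = P⊆∁⁅v⁆ v∉P

lemma5p1 : (G : Graph) → MinimalNonWeaklyFPE G → (v : Fin (Graph.n G)) →
           ¬ (∀ (w : Fin (Graph.n G)) → w ≢ v → Graph._~_ G v w)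
lemma5p1 G (not-weaklyFPE , minimal) v universal =
  not-weaklyFPE (weaklyFPE-∁⁅v⁆⇒weaklyFPE G universal (minimal (∁ ⁅ v ⁆) (∁⁅x⁆⊂⊤ v)))
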